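{- If a connected graph $G$ is a closure, then $md(G) = 1$.
   Context: Two edges $e, e'$ of a graph $G$ satisfy the relation $\theta$ if there is a sequence of subgraphs $G_1, \dots, G_k$ of $G$, each isomorphic to a triangle $K_3$ or to $K_{2,3}$, such that $e \in E(G_1)$, $e' \in E(G_k)$, and $E(G_i)\cap E(G_{i+1}) \ne \emptyset$ for all $i \in [k-1]$. $G$ is a closure if every two edges of $G$ satisfy $\theta$. An edge-coloring of $G$ is a map $\Gamma: E(G) \to [k]$ (adjacent edges may receive the same color). An edge-cut is monochromatic if all of its edges have the same color. An edge-coloring is a monochromatic disconnection coloring (MD-coloring) if any two distinct vertices $u,v$ are separated by a monochromatic edge-cut (equivalently, for some color $i$, $u$ and $v$ lie in different components of the graph obtained by deleting all edges of color $i$). For a connected graph $G$, $md(G)$ is the maximum number of colors in an MD-coloring of $G$. -}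

module Defs where

open import Data.Nat using (ℕ; _≤_; _<_)
open import Data.Fin using (Fin; zero; suc; toℕ)
open import Data.Bool using (Bool; true; false; T; _∧_; not)
open import Data.Product using (Σ; ∃; _×_; _,_)
open import Data.Sum using (_⊎_)
open import Relation.Binary.PropositionalEquality using (_≡_; _≢_)
open import Relation.Nullary using (¬_)

record Graph : Set where
  field
    n      : ℕ
    adj    : Fin n → Fin n → Bool
    sym    : ∀ u v → adj u v ≡ adj v u
    irrefl : ∀ u → adj u u ≡ false
open Graph public

data Reach {m : ℕ} (E : Fin m → Fin m → Set) : Fin m → Fin m → Set where
  here : ∀ {u} → Reach E u u
  step : ∀ {u w v} → E u w → Reach E w v → Reach E u v

Connected : Graph → Set
Connected G = ∀ (u v : Fin (n G)) → Reach (λ x y → T (adj G x y)) u v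

K3 : Graph
K3 = record { n = 3 ; adj = λ a b → not (toℕ a Data.Nat.≡ᵇ toℕ b)
            ; sym = s ; irrefl = i }
  where
  open import Data.Nat using (_≡ᵇ_)
  s : ∀ (u v : Fin 3) → not (toℕ u ≡ᵇ toℕ v) ≡ not (toℕ v ≡ᵇ toℕ u)
  s zero zero = _≡_.refl
  s zero (suc zero) = _≡_.refl
  s zero (suc (suc zero)) = _≡_.refl
  s (suc zero) zero = _≡_.refl
  s (suc zero) (suc zero) = _≡_.refl
  s (suc zero) (suc (suc zero)) = _≡_.refl
  s (suc (suc zero)) zero = _≡_.refl
  s (suc (suc zero)) (suc zero) = _≡_.refl
  s (suc (suc zero)) (suc (suc zero)) = _≡_.refl
  i : ∀ (u : Fin 3) → not (toℕ u ≡ᵇ toℕ u) ≡ false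
  i zero = _≡_.refl
  i (suc zero) = _≡_.refl
  i (suc (suc zero)) = _≡_.refl

side : Fin 5 → Bool
side zero = true
side (suc zero) = true
side _ = false

K23 : Graph
K23 = record { n = 5 ; adj = λ a b → xor (side a) (side b) ; sym = s ; irrefl = i }
  where
  xor : Bool → Bool → Bool
  xor true true = false
  xor true false = true
  xor false true = true
  xor false false = false
  s : ∀ u v → xor (side u) (side v) ≡ xor (side v) (side u)
  s u v with side u | side v
  ... | true | true = _≡_.refl
  ... | true | false = _≡_.refl
  ... | false | true = _≡_.refl
  ... | false | false = _≡_.refl
  i : ∀ u → xor (side u) (side u) ≡ false
  i u with side u
  ... | true = _≡_.refl
  ... | false = _≡_.refl

-- A subgraph of G isomorphic to H: an injective adjacency-preserving map
-- V(H) → V(G); its edge set is the image of E(H).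
record Copy (H G : Graph) : Set where
  field
    f   : Fin (n H) → Fin (n G)
    inj : ∀ a b → f a ≡ f b → a ≡ b
    hom : ∀ a b → T (adj H a b) → T (adj G (f a) (f b))
open Copy public

EdgeIn : ∀ {H G} → Copy H G → Fin (n G) → Fin (n G) → Set
EdgeIn {H} c u v = Σ (Fin (n H)) λ a → Σ (Fin (n H)) λ b →
  T (adj H a b) × f c a ≡ u × f c b ≡ v

Piece : Graph → Set
Piece G = Copy K3 G ⊎ Copy K23 G

EdgeInP : ∀ {G} → Piece G → Fin (n G) → Fin (n G) → Set
EdgeInP (Data.Sum.inj₁ c) u v = EdgeIn c u v
EdgeInP (Data.Sum.inj₂ c) u v = EdgeIn c u v

ShareEdge : ∀ {G} → Piece G → Piece G → Set
ShareEdge {G} P Q = Σ (Fin (n G)) λ x → Σ (Fin (n G)) λ y →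
  EdgeInP P x y × EdgeInP Q x y

data Chain {G : Graph} : Piece G → Fin (n G) → Fin (n G) → Set where
  done : ∀ {P u' v'} → EdgeInP P u' v' → Chain P u' v'
  next : ∀ {P Q u' v'} → ShareEdge P Q → Chain Q u' v' → Chain P u' v'

Theta : (G : Graph) → (u v u' v' : Fin (n G)) → Set
Theta G u v u' v' = Σ (Piece G) λ P → EdgeInP P u v × Chain P u' v'

Closure : Graph → Set
Closure G = ∀ u v u' v' → T (adj G u v) → T (adj G u' v') → Theta G u v u' v'

-- An edge-coloring with colors Fin k (values on non-edges are irrelevant).
record Coloring (G : Graph) (k : ℕ) : Set where
  field
    col    : Fin (n G) → Fin (n G) → Fin k
    colSym : ∀ u v → T (adj G u v) → col u v ≡ col v u
open Coloring public

UsesAll : ∀ {G k} → Coloring G k → Set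
UsesAll {G} {k} c = ∀ (i : Fin k) → Σ (Fin (n G)) λ u → Σ (Fin (n G)) λ v →
  T (adj G u v) × col c u v ≡ i

AdjAvoid : ∀ {G k} → Coloring G k → Fin k → Fin (n G) → Fin (n G) → Set
AdjAvoid {G} c i x y = T (adj G x y) × col c x y ≢ i

IsMDColoring : ∀ {G k} → Coloring G k → Set
IsMDColoring {G} {k} c = ∀ (u v : Fin (n G)) → u ≢ v →
  Σ (Fin k) λ i → ¬ Reach (AdjAvoid c i) u v

MDNumber : Graph → ℕ → Set
MDNumber G m =
  (Σ (Coloring G m) λ c → UsesAll c × IsMDColoring c) ×
  (∀ k (c : Coloring G k) → UsesAll c → IsMDColoring c → k ≤ m)

module Submission where

-- If a colour i separates two
-- vertices u and v, then every u–v walk contains an edge of colour i; for an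
-- edge uv the separating colour is necessarily the colour of uv, so the colour
-- of an edge recurs on every other walk between its ends.  Applied to the short
-- walks inside a triangle and inside a K_{2,3}, this forces both graphs to be
-- monochromatic; the K_{2,3} case is reduced to a purely combinatorial fact
-- about the six colours on its edges.  Consecutive pieces of a θ-chain share
-- an edge, so θ-related edges have equal colours; in a closure all edges then
-- carry one colour, hence an MD-coloring using all its k colours has k ≤ 1.
-- Conversely the constant colouring is an MD-coloring, and it uses its colour
-- because a connected graph on at least two vertices has an edge.

open import Defs hiding (sym)
open import Data.Nat using (ℕ; _<_; _≤_; z≤n; s≤s)
open import Data.Fin using (Fin; zero; suc)
open import Data.Fin.Properties using (_≟_; suc-injective)
open import Data.Bool using (T)
open import Data.Unit using (tt)
open import Data.Empty using (⊥-elim)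
open import Data.Product using (Σ; _×_; _,_; proj₁; proj₂)
open import Data.Sum using (_⊎_; inj₁; inj₂; map₁; map₂)
import Data.Sum as Sum
open import Relation.Nullary using (¬_; yes; no)
open import Relation.Binary.Definitions using (DecidableEquality)
open import Relation.Binary.PropositionalEquality using (_≡_; _≢_; refl; sym; trans; subst)

otherTwo : (w : Fin 3) → Σ (Fin 3) λ u → Σ (Fin 3) λ v → w ≢ u × w ≢ v × u ≢ v
otherTwo zero = suc zero , suc (suc zero) , (λ ()) , (λ ()) , (λ ())
otherTwo (suc zero) = zero , suc (suc zero) , (λ ()) , (λ ()) , (λ ())
otherTwo (suc (suc zero)) = zero , suc zero , (λ ()) , (λ ()) , (λ ())

module Colours {A : Set} where

  either-equal : {p q j : A} → q ≡ p → p ≡ j ⊎ q ≡ j → p ≡ j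
  either-equal _ (inj₁ p≡j) = p≡j
  either-equal refl (inj₂ q≡j) = q≡j

  pairwise-covered : {x y z : A} →
    z ≡ x ⊎ y ≡ x → x ≡ y ⊎ z ≡ y → x ≡ z ⊎ y ≡ z → y ≡ x × z ≡ x
  pairwise-covered (inj₁ refl) (inj₁ refl) _ = refl , refl
  pairwise-covered (inj₁ refl) (inj₂ refl) _ = refl , refl
  pairwise-covered (inj₂ refl) _ (inj₁ refl) = refl , refl
  pairwise-covered (inj₂ refl) _ (inj₂ refl) = refl , refl

  -- In a K_{2,3} with hubs a, b and leaves 0,1,2 write α l, β l for the colours
  -- of the edges a–l, b–l.  The three kinds of separations give:
  -- separating a from leaf w, colour α w recurs on the walk a–u–b–w;
  HubLeafCut : (α β : Fin 3 → A) → Set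
  HubLeafCut α β = ∀ w u → α u ≡ α w ⊎ β u ≡ α w ⊎ β w ≡ α w

  -- separating leaves w ≠ u, one colour meets both walks w–a–u and w–b–u;
  LeafLeafCut : (α β : Fin 3 → A) → Set
  LeafLeafCut α β = ∀ w u → w ≢ u →
    Σ A λ j → (α w ≡ j ⊎ α u ≡ j) × (β w ≡ j ⊎ β u ≡ j)

  -- separating the hubs, one colour meets every walk a–l–b.
  HubHubCut : (α β : Fin 3 → A) → Set
  HubHubCut α β = Σ A λ j → ∀ l → α l ≡ j ⊎ β l ≡ j

  -- Two leaves whose spoke colours agree and are separated by a colour j
  -- have both spokes coloured j, so their two spoke colours are equal.
  twins-balanced : {p q p' q' : A} → p' ≡ p → q' ≡ q →
    Σ A (λ j → (p ≡ j ⊎ p' ≡ j) × (q ≡ j ⊎ q' ≡ j)) → p ≡ q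
  twins-balanced p'≡p q'≡q (j , pj , qj) =
    trans (either-equal p'≡p pj) (sym (either-equal q'≡q qj))

  -- Relative to a leaf with spoke colours p ≠ q, the hub–leaf cuts force
  -- another leaf's spoke colours to be (p , q) or (q , p).
  data Orientation (p q p' q' : A) : Set where
    aligned : p' ≡ p → q' ≡ q → Orientation p q p' q'
    crossed : p' ≡ q → q' ≡ p → Orientation p q p' q'

  orientation : {p q p' q' : A} → p ≢ q →
    p' ≡ p ⊎ q' ≡ p ⊎ q ≡ p → q' ≡ q ⊎ p' ≡ q ⊎ p ≡ q → Orientation p q p' q'
  orientation p≢q (inj₁ p'≡p) (inj₁ q'≡q) = aligned p'≡p q'≡q
  orientation p≢q (inj₁ refl) (inj₂ (inj₁ p≡q)) = ⊥-elim (p≢q p≡q)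
  orientation p≢q (inj₂ (inj₁ q'≡p)) (inj₂ (inj₁ p'≡q)) = crossed p'≡q q'≡p
  orientation p≢q (inj₂ (inj₁ refl)) (inj₁ q≡q') = ⊥-elim (p≢q q≡q')
  orientation p≢q (inj₂ (inj₂ q≡p)) _ = ⊥-elim (p≢q (sym q≡p))
  orientation p≢q _ (inj₂ (inj₂ p≡q)) = ⊥-elim (p≢q p≡q)

  -- Every leaf sees the same colour from both hubs: otherwise, of the three
  -- leaves, two have the same orientation, contradicting `twins-balanced'.
  balanced : DecidableEquality A → {α β : Fin 3 → A} →
    HubLeafCut α β → HubLeafCut β α → LeafLeafCut α β → ∀ w → α w ≡ β w
  balanced _≟ᴬ_ {α} {β} cutα cutβ cutLeaves w with α w ≟ᴬ β w
  ... | yes same = same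
  ... | no differ with otherTwo w
  ... | u , v , w≢u , w≢v , u≢v
      with orientation differ (cutα w u) (cutβ w u) | orientation differ (cutα w v) (cutβ w v)
  ... | aligned αu βu | _ = ⊥-elim (differ (twins-balanced αu βu (cutLeaves w u w≢u)))
  ... | _ | aligned αv βv = ⊥-elim (differ (twins-balanced αv βv (cutLeaves w v w≢v)))
  ... | crossed αu βu | crossed αv βv =
        ⊥-elim (differ (sym (trans (sym αu) (trans uBalanced βu))))
    where
    uBalanced : α u ≡ β u
    uBalanced = twins-balanced (trans αv (sym αu)) (trans βv (sym βu)) (cutLeaves u v u≢v)

  k23-constant : DecidableEquality A → {α β : Fin 3 → A} →
    HubLeafCut α β → HubLeafCut β α → LeafLeafCut α β → HubHubCut α β →
    Σ A λ j → ∀ l → α l ≡ j × β l ≡ j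
  k23-constant dec {α} {β} cutα cutβ cutLeaves (j , cutHubs) = j , spokes
    where
    spokes : ∀ l → α l ≡ j × β l ≡ j
    spokes l = αj , trans (sym (balanced dec cutα cutβ cutLeaves l)) αj
      where
      αj : α l ≡ j
      αj = either-equal (sym (balanced dec cutα cutβ cutLeaves l)) (cutHubs l)

open Colours

module MDColouring (G : Graph) {k : ℕ} (c : Coloring G k) (md : IsMDColoring c) where

  V : Set
  V = Fin (n G)

  E : V → V → Set
  E x y = T (adj G x y)

  colour : V → V → Fin k
  colour = col c

  edge-sym : ∀ {x y} → E x y → E y x
  edge-sym {x} {y} e = subst T (Graph.sym G x y) e

  edge-distinct : ∀ {x y} → E x y → x ≢ y
  edge-distinct {x} e refl = subst T (irrefl G x) e

  flip : ∀ {x y i} → E x y → colour x y ≡ i → colour y x ≡ i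
  flip {x} {y} e h = trans (sym (colSym c x y e)) h

  data Hits (i : Fin k) : ∀ {u v} → Reach E u v → Set where
    now   : ∀ {u w v} {e : E u w} {r : Reach E w v} → colour u w ≡ i → Hits i (step e r)
    later : ∀ {u w v} {e : E u w} {r : Reach E w v} → Hits i r → Hits i (step e r)

  separator-hits : ∀ {i u v} → ¬ Reach (AdjAvoid c i) u v → (r : Reach E u v) → Hits i r
  separator-hits separated here = ⊥-elim (separated here)
  separator-hits {i} separated (step {u} {w} e r) with colour u w ≟ i
  ... | yes hit = now hit
  ... | no miss = later (separator-hits (λ r' → separated (step (e , miss) r')) r)

  common-colour : ∀ {u v} → u ≢ v → Σ (Fin k) λ i → ∀ (r : Reach E u v) → Hits i r
  common-colour {u} {v} u≢v with md u v u≢v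
  ... | i , separated = i , separator-hits separated

  -- The colour of an edge uv recurs on every u–v walk (the one-edge walk shows
  -- that it is the separating colour).
  edge-colour-recurs : ∀ {u v} (e : E u v) (r : Reach E u v) → Hits (colour u v) r
  edge-colour-recurs e r with common-colour (edge-distinct e)
  ... | i , hits with hits (step e here)
  ... | now uv≡i = subst (λ j → Hits j r) (sym uv≡i) (hits r)
  ... | later ()

  hits₂ : ∀ {i u w v} {e₁ : E u w} {e₂ : E w v} →
    Hits i (step e₁ (step e₂ here)) → colour u w ≡ i ⊎ colour w v ≡ i
  hits₂ (now h) = inj₁ h
  hits₂ (later (now h)) = inj₂ h
  hits₂ (later (later ()))

  hits₃ : ∀ {i u w w' v} {e₁ : E u w} {e₂ : E w w'} {e₃ : E w' v} →
    Hits i (step e₁ (step e₂ (step e₃ here))) →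
    colour u w ≡ i ⊎ colour w w' ≡ i ⊎ colour w' v ≡ i
  hits₃ (now h) = inj₁ h
  hits₃ (later (now h)) = inj₂ (inj₁ h)
  hits₃ (later (later (now h))) = inj₂ (inj₂ h)
  hits₃ (later (later (later ())))

  triangle-edge : ∀ {a b d} → E a b → E a d → E d b →
    colour a d ≡ colour a b ⊎ colour d b ≡ colour a b
  triangle-edge ab ad db = hits₂ (edge-colour-recurs ab (step ad (step db here)))

  triangle-monochromatic : ∀ {a b d} → E a b → E b d → E a d →
    colour b d ≡ colour a b × colour a d ≡ colour a b
  triangle-monochromatic ab bd ad = pairwise-covered
    (map₂ (flip (edge-sym bd)) (triangle-edge ab ad (edge-sym bd)))
    (map₁ (flip (edge-sym ab)) (triangle-edge bd (edge-sym ab) ad))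
    (triangle-edge ad ab bd)

  four-cycle-edge : ∀ {a b u w} → E a u → E u b → E b w → E a w →
    colour a u ≡ colour a w ⊎ colour b u ≡ colour a w ⊎ colour b w ≡ colour a w
  four-cycle-edge au ub bw aw =
    map₂ (map₁ (flip ub)) (hits₃ (edge-colour-recurs aw (step au (step ub (step bw here)))))

  common-neighbours-cut : ∀ {L : Set} {u v} → u ≢ v → (x : L → V) →
    (∀ l → E (x l) u) → (∀ l → E (x l) v) →
    Σ (Fin k) λ j → ∀ l → colour (x l) u ≡ j ⊎ colour (x l) v ≡ j
  common-neighbours-cut u≢v x xu xv with common-colour u≢v
  ... | j , hits = j , λ l →
        map₁ (flip (edge-sym (xu l))) (hits₂ (hits (step (edge-sym (xu l)) (step (xv l) here))))

  MonochromaticCopy : ∀ {H} → Copy H G → Set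
  MonochromaticCopy {H} cp =
    Σ (Fin k) λ j → ∀ p q → T (adj H p q) → colour (f cp p) (f cp q) ≡ j

  triangle-copy : (cp : Copy K3 G) → MonochromaticCopy cp
  triangle-copy cp = colour (v 0F) (v 1F) , edge
    where
    0F 1F 2F : Fin 3
    0F = zero
    1F = suc zero
    2F = suc (suc zero)
    v : Fin 3 → V
    v = f cp
    sides : colour (v 1F) (v 2F) ≡ colour (v 0F) (v 1F) × colour (v 0F) (v 2F) ≡ colour (v 0F) (v 1F)
    sides = triangle-monochromatic (hom cp 0F 1F tt) (hom cp 1F 2F tt) (hom cp 0F 2F tt)
    edge : ∀ p q → T (adj K3 p q) → colour (v p) (v q) ≡ colour (v 0F) (v 1F)
    edge zero zero ()
    edge zero (suc zero) _ = refl
    edge zero (suc (suc zero)) _ = proj₂ sides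
    edge (suc zero) zero _ = flip (hom cp 0F 1F tt) refl
    edge (suc zero) (suc zero) ()
    edge (suc zero) (suc (suc zero)) _ = proj₁ sides
    edge (suc (suc zero)) zero _ = flip (hom cp 0F 2F tt) (proj₂ sides)
    edge (suc (suc zero)) (suc zero) _ = flip (hom cp 1F 2F tt) (proj₁ sides)
    edge (suc (suc zero)) (suc (suc zero)) ()

  module K23Copy (cp : Copy K23 G) where

    hub : Fin 2 → V
    hub zero = f cp zero
    hub (suc zero) = f cp (suc zero)

    leaf : Fin 3 → V
    leaf l = f cp (suc (suc l))

    spoke : ∀ h l → E (hub h) (leaf l)
    spoke zero l = hom cp zero (suc (suc l)) tt
    spoke (suc zero) l = hom cp (suc zero) (suc (suc l)) tt

    spokeColour : Fin 2 → Fin 3 → Fin k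
    spokeColour h l = colour (hub h) (leaf l)

    hubs-distinct : hub zero ≢ hub (suc zero)
    hubs-distinct same with inj cp zero (suc zero) same
    ... | ()

    leaves-distinct : ∀ {w u} → w ≢ u → leaf w ≢ leaf u
    leaves-distinct w≢u same = w≢u (suc-injective (suc-injective (inj cp _ _ same)))

    hub-leaf-cut : ∀ h h' → HubLeafCut (spokeColour h) (spokeColour h')
    hub-leaf-cut h h' w u =
      four-cycle-edge (spoke h u) (edge-sym (spoke h' u)) (spoke h' w) (spoke h w)

    leaf-leaf-cut : LeafLeafCut (spokeColour zero) (spokeColour (suc zero))
    leaf-leaf-cut w u w≢u with common-neighbours-cut (leaves-distinct w≢u) hub
                                 (λ h → spoke h w) (λ h → spoke h u)
    ... | j , cut = j , cut zero , cut (suc zero)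

    hub-hub-cut : HubHubCut (spokeColour zero) (spokeColour (suc zero))
    hub-hub-cut with common-neighbours-cut hubs-distinct leaf
                       (λ l → edge-sym (spoke zero l)) (λ l → edge-sym (spoke (suc zero) l))
    ... | j , cut = j , λ l →
          Sum.map (flip (edge-sym (spoke zero l))) (flip (edge-sym (spoke (suc zero) l))) (cut l)

    monochromatic : MonochromaticCopy cp
    monochromatic with k23-constant _≟_ (hub-leaf-cut zero (suc zero))
                         (hub-leaf-cut (suc zero) zero) leaf-leaf-cut hub-hub-cut
    ... | j , spokes = j , edge
      where
      edge : ∀ p q → T (adj K23 p q) → colour (f cp p) (f cp q) ≡ j
      edge zero (suc (suc l)) _ = proj₁ (spokes l)
      edge (suc zero) (suc (suc l)) _ = proj₂ (spokes l)
      edge (suc (suc l)) zero _ = flip (spoke zero l) (proj₁ (spokes l))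
      edge (suc (suc l)) (suc zero) _ = flip (spoke (suc zero) l) (proj₂ (spokes l))

  copy-edges : ∀ {H} (cp : Copy H G) → MonochromaticCopy cp →
    Σ (Fin k) λ j → ∀ {u v} → EdgeIn cp u v → colour u v ≡ j
  copy-edges cp (j , mono) = j , λ { (p , q , t , refl , refl) → mono p q t }

  piece-monochromatic : (P : Piece G) →
    Σ (Fin k) λ j → ∀ {u v} → EdgeInP P u v → colour u v ≡ j
  piece-monochromatic (inj₁ cp) = copy-edges cp (triangle-copy cp)
  piece-monochromatic (inj₂ cp) = copy-edges cp (K23Copy.monochromatic cp)

  pieceColour : Piece G → Fin k
  pieceColour P = proj₁ (piece-monochromatic P)

  on-piece : (P : Piece G) → ∀ {u v} → EdgeInP P u v → colour u v ≡ pieceColour P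
  on-piece P = proj₂ (piece-monochromatic P)

  -- Pieces sharing an edge have the same colour, so a chain ends in that colour.
  chain-colour : ∀ {P u v} → Chain P u v → colour u v ≡ pieceColour P
  chain-colour {P} (done uv∈P) = on-piece P uv∈P
  chain-colour {P} (next {Q = Q} (x , y , xy∈P , xy∈Q) rest) =
    trans (chain-colour rest) (trans (sym (on-piece Q xy∈Q)) (on-piece P xy∈P))

  theta-colour : ∀ {u v u' v'} → Theta G u v u' v' → colour u v ≡ colour u' v'
  theta-colour (P , uv∈P , chain) = trans (on-piece P uv∈P) (sym (chain-colour chain))

  closure-monochromatic : Closure G → ∀ {u v u' v'} → E u v → E u' v' → colour u v ≡ colour u' v'
  closure-monochromatic closure {u} {v} {u'} {v'} uv u'v' = theta-colour (closure u v u' v' uv u'v')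

at-most-one-colour : ∀ {G k} (c : Coloring G k) → UsesAll c →
  (∀ {u v u' v'} → T (adj G u v) → T (adj G u' v') → col c u v ≡ col c u' v') → k ≤ 1
at-most-one-colour {k = ℕ.zero} _ _ _ = z≤n
at-most-one-colour {k = ℕ.suc ℕ.zero} _ _ _ = s≤s z≤n
at-most-one-colour {k = ℕ.suc (ℕ.suc _)} c uses mono with uses zero | uses (suc zero)
... | u , v , uv , uv≡0 | u' , v' , u'v' , u'v'≡1 with trans (sym uv≡0) (trans (mono uv u'v') u'v'≡1)
... | ()

monochrome : (G : Graph) → Coloring G 1
monochrome G = record { col = λ _ _ → zero ; colSym = λ _ _ _ → refl }

-- Deleting the only colour deletes every edge, separating all distinct vertices.
monochrome-is-MD : (G : Graph) → IsMDColoring (monochrome G)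
monochrome-is-MD G u v u≢v = zero , stuck
  where
  stuck : ¬ Reach (AdjAvoid (monochrome G) zero) u v
  stuck here = u≢v refl
  stuck (step (_ , notZero) _) = notZero refl

two-distinct : ∀ {m} → 1 < m → Σ (Fin m) λ u → Σ (Fin m) λ v → u ≢ v
two-distinct (s≤s (s≤s _)) = zero , suc zero , λ ()

walk-has-edge : ∀ {m} {E : Fin m → Fin m → Set} {u v} → u ≢ v → Reach E u v →
  Σ (Fin m) λ x → Σ (Fin m) λ y → E x y
walk-has-edge u≢v here = ⊥-elim (u≢v refl)
walk-has-edge _ (step {u} {w} e _) = u , w , e

-- A connected graph on at least two vertices has an edge, so colour 0 is used.
monochrome-uses-all : (G : Graph) → 1 < n G → Connected G → UsesAll (monochrome G)
monochrome-uses-all G twoVertices connected zero with two-distinct twoVertices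
... | u , v , u≢v with walk-has-edge u≢v (connected u v)
... | x , y , xy = x , y , xy , refl

lemma2p1 : (G : Graph) → 1 < n G → Connected G → Closure G → MDNumber G 1
lemma2p1 G twoVertices connected closure =
  (monochrome G , monochrome-uses-all G twoVertices connected , monochrome-is-MD G) ,
  λ k c uses isMD → at-most-one-colour c uses (MDColouring.closure-monochromatic G c isMD closure)
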